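{- Let $d\ge1$ and $l\ge1$ be integers, let $n_1,\dots,n_d$ be positive integers, let $M\subset\mathcal{P}([d])$ be non-empty, and let $A\subset[n_1]\times\dots\times[n_d]$. Assume that for every $B\in M$, every non-empty $C\subset B$, and every $C$-subspace $S$, the set $A\cap S$ has $C^*$-covering number at most $l$, where $C^*=\{C\setminus\{j\}: j\in C\}$. Then $|A|\le l^{\tau}\,\mathrm{c}_M(A)$, where $\tau$ is the largest size of an element $B\in M$.
   Context: $[k]=\{1,\dots,k\}$. For $B \subset [d]$, a $B$-subspace is a maximal subset $S$ of $[n_1]\times\dots\times[n_d]$ such that $x_i = y_i$ whenever $x,y\in S$ and $i \notin B$. For non-empty $M\subset\mathcal{P}([d])$, an $M$-subspace is a $B$-subspace for some $B\in M$. The $M$-covering number $\mathrm{c}_M(A)$ is the smallest nonnegative integer $k$ such that $A$ is contained in a union of $k$ $M$-subspaces (this applies in particular to $M=C^*$). -}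

module Defs where

open import Data.Nat using (ℕ; _≤_; _⊔_)
open import Data.Fin using (Fin)
open import Data.Vec using (Vec; lookup)
open import Data.List using (List; length; foldr; map)
open import Data.Product using (Σ; ∃; _×_)
open import Data.Fin.Subset as S using (Subset; _∉_; _-_; ∣_∣)
import Data.List.Membership.Propositional as LM
open import Data.List.Relation.Unary.Any using (Any)
open import Relation.Binary.PropositionalEquality using (_≡_)

InGrid : ∀ {d} → Vec ℕ d → Vec ℕ d → Set
InGrid {d} n x = (i : Fin d) → 1 ≤ lookup x i × lookup x i ≤ lookup n i

-- A B-subspace of the grid is determined by a grid point p (its "base
-- point"): it is the set of grid points agreeing with p outside B.
record SubspaceData {d : ℕ} (n : Vec ℕ d) : Set where
  constructor subspace
  field
    dir  : Subset d
    base : Vec ℕ d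
    base-in-grid : InGrid n base
open SubspaceData public

_∈Sub_ : ∀ {d} {n : Vec ℕ d} → Vec ℕ d → SubspaceData n → Set
_∈Sub_ {d} {n} x S = InGrid n x × ((i : Fin d) → i ∉ dir S → lookup x i ≡ lookup (base S) i)

record Cover {d : ℕ} (n : Vec ℕ d) (F : Subset d → Set) (X : Vec ℕ d → Set) : Set where
  field
    subspaces : List (SubspaceData n)
    in-family : (S : SubspaceData n) → S LM.∈ subspaces → F (dir S)
    covers    : (x : Vec ℕ d) → X x → Any (λ S → x ∈Sub S) subspaces
open Cover public

IsCoveringNumber : ∀ {d} (n : Vec ℕ d) (F : Subset d → Set) (X : Vec ℕ d → Set) → ℕ → Set
IsCoveringNumber n F X c =
  Σ (Cover n F X) (λ K → length (subspaces K) ≡ c)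
  × ((K : Cover n F X) → c ≤ length (subspaces K))

Star : ∀ {d} → Subset d → Subset d → Set
Star C B = ∃ λ j → j S.∈ C × B ≡ C - j

InList : ∀ {d} → List (Subset d) → Subset d → Set
InList M B = B LM.∈ M

maxSize : ∀ {d} → List (Subset d) → ℕ
maxSize M = foldr _⊔_ 0 (map ∣_∣ M)

{-# OPTIONS --safe #-}
module Submission where

-- Induct on the direction set C of a subspace S.  If C is empty, S is a
-- single point.  Otherwise A ∩ S is covered by at most l subspaces whose
-- directions C ∖ {j} are one smaller, each of which meets A in at most
-- l ^ (∣C∣ - 1) points; so ∣A ∩ S∣ ≤ l ^ ∣C∣.  An optimal M-cover of A then
-- consists of c_M(A) subspaces with directions of size at most τ.

open import Defs
open import Data.Nat using (ℕ; _≤_; _*_; _^_; _+_; zero; suc; z≤n; s≤s; >-nonZero)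
open import Data.Nat.Properties
  using (≤-trans; ≤-pred; +-mono-≤; *-monoˡ-≤; *-comm; m^n>0; m≤m⊔n; m≤n⊔m; <⇒≱; module ≤-Reasoning)
open import Data.Fin using (Fin)
open import Data.Vec using (Vec; lookup; tabulate)
open import Data.Vec.Properties using (tabulate∘lookup; tabulate-cong)
open import Data.List using (List; []; _∷_; length)
open import Data.List.Relation.Unary.All using (All; []; _∷_)
import Data.List.Relation.Unary.All as All
open import Data.List.Relation.Unary.Any using (Any; here; there)
import Data.List.Relation.Unary.Any as Any
open import Data.List.Relation.Unary.Unique.Propositional using (Unique)
open import Data.List.Relation.Unary.AllPairs using ([]; _∷_)
open import Data.List.Membership.Propositional using (_∈_)
open import Data.List.Relation.Binary.Sublist.Propositional using ([]; _∷_; _∷ʳ_) renaming (_⊆_ to _⊑_)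
open import Data.List.Relation.Binary.Sublist.Propositional.Properties using (All-resp-⊆)
open import Data.List.Relation.Ternary.Interleaving.Propositional using (Interleaving; []; consˡ; consʳ)
open import Data.List.Relation.Ternary.Interleaving.Properties using (interleave-length)
open import Data.Fin.Subset using (Subset; _⊆_; _∉_; Nonempty; Empty; ∣_∣; ⁅_⁆)
open import Data.Fin.Subset.Properties using (nonempty?; x∈p⇒∣p-x∣<∣p∣; p─q⊆p; ⊆-refl; ⊆-trans)
open import Data.Product using (Σ; ∃₂; _×_; _,_; proj₂)
open import Data.Sum using (_⊎_; inj₁; inj₂)
open import Relation.Binary.PropositionalEquality using (_≡_; _≢_; refl; sym; trans; cong; subst; module ≡-Reasoning)
open import Relation.Nullary using (yes; no)
open import Data.Empty using (⊥-elim)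

module _ {X : Set} where

  AtMost : ℕ → (X → Set) → Set
  AtMost k P = (ys : List X) → Unique ys → All P ys → length ys ≤ k

  Unique-resp-⊑ : {xs ys : List X} → xs ⊑ ys → Unique ys → Unique xs
  Unique-resp-⊑ []            []       = []
  Unique-resp-⊑ (y ∷ʳ xs⊑ys)  (_ ∷ u)  = Unique-resp-⊑ xs⊑ys u
  Unique-resp-⊑ (refl ∷ xs⊑ys) (y∉ ∷ u) = All-resp-⊆ xs⊑ys y∉ ∷ Unique-resp-⊑ xs⊑ys u

  interleaving⇒⊑ˡ : {xs ys zs : List X} → Interleaving xs ys zs → xs ⊑ zs
  interleaving⇒⊑ˡ []         = []
  interleaving⇒⊑ˡ (consˡ sp) = refl ∷ interleaving⇒⊑ˡ sp
  interleaving⇒⊑ˡ (consʳ sp) = _ ∷ʳ interleaving⇒⊑ˡ sp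

  interleaving⇒⊑ʳ : {xs ys zs : List X} → Interleaving xs ys zs → ys ⊑ zs
  interleaving⇒⊑ʳ []         = []
  interleaving⇒⊑ʳ (consˡ sp) = _ ∷ʳ interleaving⇒⊑ʳ sp
  interleaving⇒⊑ʳ (consʳ sp) = refl ∷ interleaving⇒⊑ʳ sp

  partition-⊎ : {P Q : X → Set} {zs : List X} → All (λ z → P z ⊎ Q z) zs →
                ∃₂ λ xs ys → Interleaving xs ys zs × All P xs × All Q ys
  partition-⊎ [] = [] , [] , [] , [] , []
  partition-⊎ (inj₁ p ∷ pqs) with partition-⊎ pqs
  ... | xs , ys , sp , ps , qs = _ ∷ xs , ys , consˡ sp , p ∷ ps , qs
  partition-⊎ (inj₂ q ∷ pqs) with partition-⊎ pqs
  ... | xs , ys , sp , ps , qs = xs , _ ∷ ys , consʳ sp , ps , q ∷ qs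

  atMost-mono : {a b : ℕ} {P : X → Set} → a ≤ b → AtMost a P → AtMost b P
  atMost-mono a≤b bound ys u ps = ≤-trans (bound ys u ps) a≤b

  atMost-⊆ : {k : ℕ} {P Q : X → Set} → (∀ {x} → P x → Q x) → AtMost k Q → AtMost k P
  atMost-⊆ P⊆Q bound ys u ps = bound ys u (All.map P⊆Q ps)

  atMost-∪ : {a b : ℕ} {P Q : X → Set} → AtMost a P → AtMost b Q →
             AtMost (a + b) (λ x → P x ⊎ Q x)
  atMost-∪ boundP boundQ zs u pqs with partition-⊎ pqs
  ... | xs , ys , sp , ps , qs =
    subst (_≤ _) (sym (interleave-length sp))
      (+-mono-≤ (boundP xs (Unique-resp-⊑ (interleaving⇒⊑ˡ sp) u) ps)
                (boundQ ys (Unique-resp-⊑ (interleaving⇒⊑ʳ sp) u) qs))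

  atMost-⋃ : {I : Set} {Q : I → X → Set} {k : ℕ} (is : List I) →
             (∀ i → i ∈ is → AtMost k (Q i)) →
             AtMost (length is * k) (λ x → Any (λ i → Q i x) is)
  atMost-⋃ []       _     []       _ []        = z≤n
  atMost-⋃ []       _     (_ ∷ _)  _ (() ∷ _)
  atMost-⋃ (i ∷ is) bound =
    atMost-⊆ Any.toSum
      (atMost-∪ (bound i (here refl)) (atMost-⋃ is (λ i′ i′∈is → bound i′ (there i′∈is))))

module _ {d : ℕ} {n : Vec ℕ d} where

  _∩_ : (Vec ℕ d → Set) → SubspaceData n → Vec ℕ d → Set
  (A ∩ S) x = A x × x ∈Sub S

  atMost-cover : {F : Subset d → Set} {X : Vec ℕ d → Set} {k : ℕ} (K : Cover n F X) →
                 (∀ T → F (dir T) → AtMost k (X ∩ T)) →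
                 AtMost (length (subspaces K) * k) X
  atMost-cover K bound ys u xs =
    atMost-⋃ (subspaces K) (λ T T∈K → bound T (in-family K T T∈K)) ys u
      (All.map (λ {y} x → Any.map (x ,_) (covers K y x)) xs)

  atMost-point : (S : SubspaceData n) → Empty (dir S) → AtMost 1 (_∈Sub S)
  atMost-point S _     []          _                _ = z≤n
  atMost-point S _     (_ ∷ [])    _                _ = s≤s z≤n
  atMost-point S empty (x ∷ y ∷ _) ((x≢y ∷ _) ∷ _) ((_ , x∈S) ∷ (_ , y∈S) ∷ _) = ⊥-elim (x≢y x≡y)
    where
    outside : ∀ i → i ∉ dir S
    outside i i∈S = empty (i , i∈S)

    open ≡-Reasoning
    x≡y : x ≡ y
    x≡y = begin
      x                   ≡⟨ sym (tabulate∘lookup x) ⟩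
      tabulate (lookup x) ≡⟨ tabulate-cong (λ i → trans (x∈S i (outside i)) (sym (y∈S i (outside i)))) ⟩
      tabulate (lookup y) ≡⟨ tabulate∘lookup y ⟩
      y                   ∎

  Coverable : ℕ → (Vec ℕ d → Set) → Subset d → Set
  Coverable l A C = (S : SubspaceData n) → dir S ≡ C →
                    Σ (Cover n (Star C) (A ∩ S)) (λ K → length (subspaces K) ≤ l)

  CoverableBelow : ℕ → (Vec ℕ d → Set) → Subset d → Set
  CoverableBelow l A B = (C : Subset d) → Nonempty C → C ⊆ B → Coverable l A C

  coverableBelow-⊆ : {l : ℕ} {A : Vec ℕ d → Set} {B B′ : Subset d} → B′ ⊆ B →
                     CoverableBelow l A B → CoverableBelow l A B′
  coverableBelow-⊆ B′⊆B coverable C C≢∅ C⊆B′ = coverable C C≢∅ (⊆-trans C⊆B′ B′⊆B)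

  atMost-subspace : {l : ℕ} {A : Vec ℕ d → Set} {C : Subset d} → 1 ≤ l →
                    CoverableBelow l A C → (k : ℕ) → ∣ C ∣ ≤ k →
                    (S : SubspaceData n) → dir S ≡ C → AtMost (l ^ k) (A ∩ S)
  atMost-subspace {l} {C = C} 1≤l _ k _ S refl with nonempty? C
  ... | no empty =
    atMost-mono (m^n>0 l {{>-nonZero 1≤l}} k) (atMost-⊆ proj₂ (atMost-point S empty))
  atMost-subspace 1≤l _ zero ∣C∣≤0 S refl | yes (j , j∈C) =
    ⊥-elim (<⇒≱ (x∈p⇒∣p-x∣<∣p∣ j∈C) (≤-trans ∣C∣≤0 z≤n))
  atMost-subspace {l} {A} {C} 1≤l coverable (suc k) ∣C∣≤1+k S refl | yes nonempty
    with coverable C nonempty ⊆-refl S refl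
  ... | K , ∣K∣≤l = atMost-mono (*-monoˡ-≤ (l ^ k) ∣K∣≤l) (atMost-cover K piece)
    where
    piece : ∀ T → Star C (dir T) → AtMost (l ^ k) ((A ∩ S) ∩ T)
    piece T (j , j∈C , dirT≡C-j) =
      atMost-⊆ (λ ((x∈A , _) , x∈T) → x∈A , x∈T)
        (atMost-subspace 1≤l (coverableBelow-⊆ (p─q⊆p C ⁅ j ⁆) coverable) k
          (≤-pred (≤-trans (x∈p⇒∣p-x∣<∣p∣ j∈C) ∣C∣≤1+k)) T dirT≡C-j)

size≤maxSize : ∀ {d} {M : List (Subset d)} {B : Subset d} → B ∈ M → ∣ B ∣ ≤ maxSize M
size≤maxSize {M = B ∷ M} (here refl) = m≤m⊔n ∣ B ∣ (maxSize M)
size≤maxSize {M = B ∷ M} (there B∈M) = ≤-trans (size≤maxSize B∈M) (m≤n⊔m ∣ B ∣ (maxSize M))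

proposition4p1 : (d l : ℕ) → 1 ≤ d → 1 ≤ l →
    (n : Vec ℕ d) → ((i : Fin d) → 1 ≤ lookup n i) →
    (M : List (Subset d)) → M ≢ [] →
    (A : List (Vec ℕ d)) → All (InGrid n) A → Unique A →
    ((B : Subset d) → B ∈ M → (C : Subset d) → Nonempty C → C ⊆ B →
      (S : SubspaceData n) → dir S ≡ C →
      Σ ℕ (λ c → IsCoveringNumber n (Star C) (λ x → x ∈ A × x ∈Sub S) c × c ≤ l)) →
    (c : ℕ) → IsCoveringNumber n (InList M) (λ x → x ∈ A) c →
    length A ≤ l ^ maxSize M * c
proposition4p1 d l _ 1≤l n _ M _ A _ uniqueA hyp c ((K , ∣K∣≡c) , _) = begin
  length A                       ≤⟨ atMost-cover K pieces A uniqueA (All.tabulate (λ x∈A → x∈A)) ⟩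
  length (subspaces K) * l ^ τ   ≡⟨ cong (_* l ^ τ) ∣K∣≡c ⟩
  c * l ^ τ                      ≡⟨ *-comm c (l ^ τ) ⟩
  l ^ τ * c                      ∎
  where
  open ≤-Reasoning
  τ : ℕ
  τ = maxSize M

  coverableBelow : ∀ {B} → B ∈ M → CoverableBelow l (_∈ A) B
  coverableBelow B∈M C C≢∅ C⊆B S dirS≡C with hyp _ B∈M C C≢∅ C⊆B S dirS≡C
  ... | c′ , ((K′ , ∣K′∣≡c′) , _) , c′≤l = K′ , subst (_≤ l) (sym ∣K′∣≡c′) c′≤l

  pieces : (T : SubspaceData n) → InList M (dir T) → AtMost (l ^ τ) ((_∈ A) ∩ T)
  pieces T dirT∈M = atMost-subspace 1≤l (coverableBelow dirT∈M) τ (size≤maxSize dirT∈M) T refl
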